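{- For all $n \ge 4$, $\det(M_n) = \dist(M_n) = \rho(M_n) = 2$, where $M_n$ are the classic Mycielski graphs.
   Context: The Mycielskian $\mu(G)$ of a graph $G$ with $V(G)=\{v_1,\dots,v_n\}$ has vertex set $\{v_1,\dots,v_n,u_1,\dots,u_n,w\}$, contains $G$ on $\{v_1,\dots,v_n\}$, and for each edge $v_iv_j$ of $G$ also has edges $u_iv_j$ and $v_iu_j$, plus edges $u_iw$ for all $i$; no other edges. The classic Mycielski graphs are $M_2 = K_2$ and $M_{k+1} = \mu(M_k)$ for $k \ge 2$ (so $M_3 = C_5$). A determining set of a graph $H$ is a vertex set such that only the identity automorphism fixes each of its vertices; $\det(H)$ is the minimum size of one. $\dist(H)$ is the least $d$ such that some coloring of $V(H)$ with $d$ colors is preserved (color class by color class) only by the identity automorphism. If $\dist(H)=2$, $\rho(H)$ is the minimum size of a color class over all such distinguishing $2$-colorings. -}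

module Defs where

open import Data.Nat using (ℕ; zero; suc; _+_; _∸_; _≤_; _<_)
open import Data.Fin using (Fin; zero; suc; splitAt; _≟_)
open import Data.Fin.Subset using (Subset; _∈_; ∣_∣)
open import Data.Bool using (Bool; true; false; not)
open import Data.Sum using (_⊎_; inj₁; inj₂)
open import Data.Product using (Σ; ∃; _×_; _,_)
open import Data.Vec using (tabulate)
open import Relation.Nullary using (¬_)
open import Relation.Nullary.Decidable using (⌊_⌋)
open import Relation.Binary.PropositionalEquality using (_≡_)

record Graph : Set where
  field
    N   : ℕ
    adj : Fin N → Fin N → Bool
open Graph public

K2 : Graph
K2 = record { N = 2 ; adj = λ x y → not ⌊ x ≟ y ⌋ }

-- Vertices of the Mycielskian, on Fin (suc (N + N)):
-- zero is w, suc i with i < N is v_i, suc (N + j) is u_j.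
data MKind (n : ℕ) : Set where
  vK : Fin n → MKind n
  uK : Fin n → MKind n
  wK : MKind n

kind : ∀ n → Fin (suc (n + n)) → MKind n
kind n zero = wK
kind n (suc i) with splitAt n i
... | inj₁ a = vK a
... | inj₂ b = uK b

μadj : ∀ {n} → (Fin n → Fin n → Bool) → MKind n → MKind n → Bool
μadj a (vK i) (vK j) = a i j
μadj a (uK i) (vK j) = a i j
μadj a (vK i) (uK j) = a i j
μadj a (uK i) wK     = true
μadj a wK     (uK j) = true
μadj a _      _      = false

μ : Graph → Graph
μ G = record { N = suc (N G + N G)
             ; adj = λ x y → μadj (adj G) (kind (N G) x) (kind (N G) y) }

-- M' k = M_(k+2); classic Mycielski graphs M_n = M' (n ∸ 2) for n ≥ 2
M' : ℕ → Graph
M' zero    = K2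
M' (suc k) = μ (M' k)

Mycielski : ℕ → Graph
Mycielski n = M' (n ∸ 2)

record Aut (G : Graph) : Set where
  field
    f     : Fin (N G) → Fin (N G)
    g     : Fin (N G) → Fin (N G)
    fg    : ∀ x → f (g x) ≡ x
    gf    : ∀ x → g (f x) ≡ x
    pres  : ∀ x y → adj G (f x) (f y) ≡ adj G x y
open Aut public

IsIdentity : ∀ {G} → Aut G → Set
IsIdentity σ = ∀ x → f σ x ≡ x

Determining : (G : Graph) → Subset (N G) → Set
Determining G S = (σ : Aut G) → (∀ x → x ∈ S → f σ x ≡ x) → IsIdentity σ

IsDet : Graph → ℕ → Set
IsDet G k = (Σ (Subset (N G)) λ S → Determining G S × ∣ S ∣ ≡ k)
          × (∀ S → Determining G S → k ≤ ∣ S ∣)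

Distinguishing : (G : Graph) (d : ℕ) → (Fin (N G) → Fin d) → Set
Distinguishing G d c = (σ : Aut G) → (∀ x → c (f σ x) ≡ c x) → IsIdentity σ

Distinguishable : Graph → ℕ → Set
Distinguishable G d = Σ (Fin (N G) → Fin d) (Distinguishing G d)

IsDist : Graph → ℕ → Set
IsDist G d = Distinguishable G d × (∀ d' → d' < d → ¬ Distinguishable G d')

classSize : (G : Graph) {d : ℕ} → (Fin (N G) → Fin d) → Fin d → ℕ
classSize G c i = ∣ tabulate (λ x → ⌊ c x ≟ i ⌋) ∣

-- ρ(G) = r (meaningful when dist(G) = 2): minimum color-class size over
-- all distinguishing 2-colorings
IsRho : Graph → ℕ → Set
IsRho G r = (Σ (Fin (N G) → Fin 2) λ c → Distinguishing G 2 c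
              × Σ (Fin 2) λ i → classSize G c i ≡ r)
          × (∀ c → Distinguishing G 2 c → ∀ i → r ≤ classSize G c i)

-- In μ G the apex w is the only vertex of maximum degree as soon as Δ(G) ≤ D with 1 ≤ D and 2D < |G|,
-- so every automorphism σ of μ G fixes w, maps the v's to v's and the u's to u's, and restricts to an
-- automorphism ρ of G; if G is twin-free, σ (u i) = u (ρ i). Hence if fixing a and b pointwise forces
-- the identity on G, the set {v a, u b} of μ G has trivial setwise stabiliser: it is a determining set
-- and a colour class of a distinguishing 2-colouring. Conversely, automorphisms of G lift to μ G, so if
-- every vertex stabiliser of G is nontrivial, so is every vertex stabiliser of μ G, and no set of size
-- at most one is determining. All these hypotheses pass from G to μ G, and C₅ = M₃ satisfies them.

module Submission where

open import Defs
open import Data.Nat using (ℕ; zero; suc; _+_; _≤_; _<_; _≥_; z≤n; s≤s; _≤?_)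
open import Data.Nat.Properties
  using (≤-refl; ≤-reflexive; ≤-trans; <⇒≤; <-≤-trans; ≰⇒>; n≮0; +-identityʳ; +-assoc;
         +-mono-≤; +-monoˡ-≤; m≤m+n; <⇒≱; +-0-commutativeMonoid)
open import Data.Fin using (Fin; zero; suc; splitAt; join; _↑ˡ_; _↑ʳ_; fromℕ<; _≟_)
open import Data.Fin.Properties
  using (¬Fin0; all?; any?; splitAt-↑ˡ; splitAt-↑ʳ; join-splitAt; ↑ˡ-injective; ↑ʳ-injective)
  renaming (suc-injective to fsuc-injective)
open import Data.Fin.Patterns using (0F; 1F; 2F; 3F; 4F)
open import Data.Fin.Subset using (Subset; _∈_; _⊆_; ⁅_⁆; _∪_; ∣_∣; inside; outside)
open import Data.Fin.Subset.Properties
  using (x∈⁅x⁆; x∈⁅y⁆⇒x≡y; ∣⁅x⁆∣≡1; x∈p∪q⁺; x∈p∪q⁻; x∈p⇒∣p-x∣<∣p∣; ∪-identityˡ; ∪-identityʳ)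
open import Data.Vec using (Vec; []; _∷_; here; there; tabulate; lookup)
open import Data.Vec.Properties using (lookup∘tabulate; tabulate∘lookup; tabulate-cong; lookup⇒[]=; []=⇒lookup)
open import Data.Bool using (Bool; true; false; if_then_else_)
import Data.Bool as Bool
open import Data.Sum using (_⊎_; inj₁; inj₂)
import Data.Sum as Sum
open import Data.Product using (∃; _×_; _,_; proj₁; proj₂)
open import Data.Fin.Permutation using (permutation)
open import Function using (_∘_)
open import Relation.Binary.PropositionalEquality
open import Relation.Nullary using (¬_; Dec; yes; no; contradiction; ¬?)
open import Relation.Nullary.Decidable using (⌊_⌋; isYes≗does; dec-true; from-yes; _→-dec_)
open import Algebra.Properties.CommutativeMonoid.Sum +-0-commutativeMonoid
  using (sum; sum-permute; sum-cong-≗; sum-replicate-zero)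

open ≡-Reasoning

boolToℕ : Bool → ℕ
boolToℕ true  = 1
boolToℕ false = 0

deg : (G : Graph) → Fin (N G) → ℕ
deg G x = sum (boolToℕ ∘ adj G x)

sum-↑ : ∀ m k (h : Fin (m + k) → ℕ) → sum h ≡ sum (h ∘ (_↑ˡ k)) + sum (h ∘ (m ↑ʳ_))
sum-↑ zero    k h = refl
sum-↑ (suc m) k h = trans (cong (h zero +_) (sum-↑ m k (h ∘ suc))) (sym (+-assoc (h zero) _ _))

sum-ones : ∀ m → sum {m} (λ _ → 1) ≡ m
sum-ones zero    = refl
sum-ones (suc m) = cong suc (sum-ones m)

deg-aut : ∀ {G} (σ : Aut G) x → deg G (f σ x) ≡ deg G x
deg-aut {G} σ x = begin
  deg G (f σ x)                                ≡⟨ sum-permute _ (permutation (f σ) (g σ) (fg σ) (gf σ)) ⟩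
  sum (λ y → boolToℕ (adj G (f σ x) (f σ y)))  ≡⟨ sum-cong-≗ (cong boolToℕ ∘ pres σ x) ⟩
  deg G x                                      ∎

_⁻¹ : ∀ {G} → Aut G → Aut G
_⁻¹ {G} σ = record
  { f = g σ ; g = f σ ; fg = gf σ ; gf = fg σ
  ; pres = λ x y → trans (sym (pres σ (g σ x) (g σ y))) (cong₂ (adj G) (fg σ x) (fg σ y)) }

f-injective : ∀ {G} (σ : Aut G) {x y} → f σ x ≡ f σ y → x ≡ y
f-injective σ {x} {y} e = trans (sym (gf σ x)) (trans (cong (g σ) e) (gf σ y))

Stabilises : ∀ {G} → Aut G → Subset (N G) → Set
Stabilises σ S = ∀ {x} → x ∈ S → f σ x ∈ S

adj-fixed : ∀ {G} (σ : Aut G) {c} → f σ c ≡ c → ∀ x → adj G (f σ x) c ≡ adj G x c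
adj-fixed {G} σ {c} σc≡c x = trans (cong (adj G (f σ x)) (sym σc≡c)) (pres σ x c)

fixed-by-adjacency : ∀ {G} (σ : Aut G) {a b y} → f σ a ≡ a → f σ b ≡ b →
  (∀ z → adj G z a ≡ adj G y a → adj G z b ≡ adj G y b → z ≡ y) → f σ y ≡ y
fixed-by-adjacency σ {y = y} σa≡a σb≡b unique = unique (f σ y) (adj-fixed σ σa≡a y) (adj-fixed σ σb≡b y)

TrivialStabiliser : (G : Graph) → Subset (N G) → Set
TrivialStabiliser G S = ∀ (σ : Aut G) → Stabilises σ S → IsIdentity σ

NontrivialVertexStabilisers : Graph → Set
NontrivialVertexStabilisers G = ∀ x → ∃ λ (τ : Aut G) → f τ x ≡ x × ¬ IsIdentity τ

trivialStabiliser⇒determining : ∀ {G S} → TrivialStabiliser G S → Determining G S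
trivialStabiliser⇒determining {S = S} trivial σ fixes =
  trivial σ (λ {x} x∈S → subst (_∈ S) (sym (fixes x x∈S)) x∈S)

indicator : ∀ {m} → Subset m → Fin m → Fin 2
indicator p x = if lookup p x then suc zero else zero

colourClass : ∀ {m d} → (Fin m → Fin d) → Fin d → Subset m
colourClass c i = tabulate (λ x → ⌊ c x ≟ i ⌋)

colourClass-indicator : ∀ {m} (p : Subset m) → colourClass (indicator p) (suc zero) ≡ p
colourClass-indicator p = trans (tabulate-cong inClass) (tabulate∘lookup p)
  where
  inClass : ∀ x → ⌊ indicator p x ≟ suc zero ⌋ ≡ lookup p x
  inClass x with lookup p x
  ... | true  = refl
  ... | false = refl

∈⇒indicator≡1 : ∀ {m} {p : Subset m} {x} → x ∈ p → indicator p x ≡ suc zero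
∈⇒indicator≡1 x∈p rewrite []=⇒lookup x∈p = refl

indicator≡1⇒∈ : ∀ {m} {p : Subset m} {x} → indicator p x ≡ suc zero → x ∈ p
indicator≡1⇒∈ {p = p} {x} with lookup p x in eq
... | true  = λ _ → lookup⇒[]= x p eq
... | false = λ ()

trivialStabiliser⇒distinguishing : ∀ {G S} → TrivialStabiliser G S → Distinguishing G 2 (indicator S)
trivialStabiliser⇒distinguishing trivial σ preserves =
  trivial σ λ {x} x∈S → indicator≡1⇒∈ (trans (preserves x) (∈⇒indicator≡1 x∈S))

∈-colourClass : ∀ {m d} {c : Fin m → Fin d} {x i} → c x ≡ i → x ∈ colourClass c i
∈-colourClass {c = c} {x} {i} cx≡i = lookup⇒[]= x _
  (trans (lookup∘tabulate _ x) (trans (isYes≗does (c x ≟ i)) (dec-true (c x ≟ i) cx≡i)))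

Fin2-≢⇒≡ : ∀ {i j k : Fin 2} → j ≢ i → k ≢ i → j ≡ k
Fin2-≢⇒≡ {zero}     {zero}     j≢i _   = contradiction refl j≢i
Fin2-≢⇒≡ {zero}     {suc zero} {zero}     _ k≢i = contradiction refl k≢i
Fin2-≢⇒≡ {zero}     {suc zero} {suc zero} _ _   = refl
Fin2-≢⇒≡ {suc zero} {suc zero} j≢i _   = contradiction refl j≢i
Fin2-≢⇒≡ {suc zero} {zero}     {zero}     _ _   = refl
Fin2-≢⇒≡ {suc zero} {zero}     {suc zero} _ k≢i = contradiction refl k≢i

-- An injective map fixing one colour class pointwise maps the other class into itself.
colourClass-determining : ∀ {G} {c : Fin (N G) → Fin 2} i → Distinguishing G 2 c → Determining G (colourClass c i)
colourClass-determining {c = c} i distinguishing σ fixes = distinguishing σ preserves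
  where
  preserves : ∀ x → c (f σ x) ≡ c x
  preserves x with c x ≟ i | c (f σ x) ≟ i
  ... | yes cx≡i  | _          = cong c (fixes x (∈-colourClass cx≡i))
  ... | no _      | yes cσx≡i  = cong c (f-injective σ (fixes (f σ x) (∈-colourClass cσx≡i)))
  ... | no cx≢i   | no cσx≢i   = Fin2-≢⇒≡ cσx≢i cx≢i

⊆-singleton : ∀ {m} → Fin m → (p : Subset m) → ∣ p ∣ ≤ 1 → ∃ λ x → p ⊆ ⁅ x ⁆
⊆-singleton () []
⊆-singleton _ (inside ∷ p) (s≤s ∣p∣≤0) = zero , λ
  { here        → here
  ; (there y∈p) → contradiction (<-≤-trans (x∈p⇒∣p-x∣<∣p∣ y∈p) ∣p∣≤0) n≮0 }
⊆-singleton _ (outside ∷ []) _ = zero , λ { (there ()) }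
⊆-singleton _ (outside ∷ p@(_ ∷ _)) ∣p∣≤1 with ⊆-singleton zero p ∣p∣≤1
... | x , p⊆⁅x⁆ = suc x , λ { (there y∈p) → there (p⊆⁅x⁆ y∈p) }

determining-size≥2 : ∀ {G} → Fin (N G) → NontrivialVertexStabilisers G → ∀ S → Determining G S → 2 ≤ ∣ S ∣
determining-size≥2 {G} x₀ nontrivial S determining = ≰⇒> ∣S∣≰1
  where
  ∣S∣≰1 : ¬ ∣ S ∣ ≤ 1
  ∣S∣≰1 ∣S∣≤1 =
    let x , S⊆⁅x⁆ = ⊆-singleton x₀ S ∣S∣≤1
        τ , τx≡x , τ≢id = nontrivial x
    in τ≢id (determining τ λ y y∈S → subst (λ y → f τ y ≡ y) (sym (x∈⁅y⁆⇒x≡y x (S⊆⁅x⁆ y∈S))) τx≡x)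

not-distinguishable-<2 : ∀ {G} → Fin (N G) → NontrivialVertexStabilisers G → ∀ d → d < 2 → ¬ Distinguishable G d
not-distinguishable-<2 x₀ _ zero _ (c , _) = ¬Fin0 (c x₀)
not-distinguishable-<2 x₀ nontrivial (suc zero) _ (c , distinguishing) =
  let τ , _ , τ≢id = nontrivial x₀ in τ≢id (distinguishing τ (λ x → Fin1-unique (c (f τ x)) (c x)))
  where
  Fin1-unique : ∀ (i j : Fin 1) → i ≡ j
  Fin1-unique zero zero = refl
not-distinguishable-<2 _ _ (suc (suc _)) (s≤s (s≤s ()))

pair : ∀ {m} → Fin m → Fin m → Subset m
pair a b = ⁅ a ⁆ ∪ ⁅ b ⁆

∣pair∣≡2 : ∀ {m} {a b : Fin m} → a ≢ b → ∣ pair a b ∣ ≡ 2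
∣pair∣≡2 {a = zero}  {zero}  a≢b = contradiction refl a≢b
∣pair∣≡2 {a = zero}  {suc b} _   = cong suc (trans (cong ∣_∣ (∪-identityˡ ⁅ b ⁆)) (∣⁅x⁆∣≡1 b))
∣pair∣≡2 {a = suc a} {zero}  _   = cong suc (trans (cong ∣_∣ (∪-identityʳ ⁅ a ⁆)) (∣⁅x⁆∣≡1 a))
∣pair∣≡2 {a = suc a} {suc b} a≢b = ∣pair∣≡2 (a≢b ∘ cong suc)

∈pair⁻ : ∀ {m} (a b : Fin m) {x} → x ∈ pair a b → x ≡ a ⊎ x ≡ b
∈pair⁻ a b = Sum.map (x∈⁅y⁆⇒x≡y a) (x∈⁅y⁆⇒x≡y b) ∘ x∈p∪q⁻ ⁅ a ⁆ ⁅ b ⁆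

∈pair⁺ˡ : ∀ {m} (a b : Fin m) → a ∈ pair a b
∈pair⁺ˡ a b = x∈p∪q⁺ (inj₁ (x∈⁅x⁆ a))

∈pair⁺ʳ : ∀ {m} (a b : Fin m) → b ∈ pair a b
∈pair⁺ʳ a b = x∈p∪q⁺ (inj₂ (x∈⁅x⁆ b))

det≡dist≡ρ≡2 : ∀ {G} {a b : Fin (N G)} → a ≢ b → TrivialStabiliser G (pair a b) → NontrivialVertexStabilisers G →
  IsDet G 2 × IsDist G 2 × IsRho G 2
det≡dist≡ρ≡2 {G} {a} {b} a≢b trivial nontrivial =
    ((pair a b , trivialStabiliser⇒determining trivial , ∣pair∣≡2 a≢b) , determining-size≥2 a nontrivial)
  , ((colouring , distinguishing) , not-distinguishable-<2 a nontrivial)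
  , ( (colouring , distinguishing , suc zero , trans (cong ∣_∣ (colourClass-indicator (pair a b))) (∣pair∣≡2 a≢b))
    , λ c c-distinguishing i → determining-size≥2 a nontrivial _ (colourClass-determining i c-distinguishing))
  where
  colouring = indicator (pair a b)
  distinguishing = trivialStabiliser⇒distinguishing trivial

-- The Mycielskian

Irreflexive : Graph → Set
Irreflexive G = ∀ x → adj G x x ≡ false

TwinFree : Graph → Set
TwinFree G = ∀ x y → (∀ z → adj G x z ≡ adj G y z) → x ≡ y

-- Under this bound the apex w is the only vertex of μ G of degree N G, and μ G satisfies it again with D = N G.
record DegreeBound (G : Graph) (D : ℕ) : Set where
  field
    deg≤D : ∀ x → deg G x ≤ D
    1≤D   : 1 ≤ D
    D+D<N : D + D < N G

someVertex : ∀ {G D} → DegreeBound G D → Fin (N G)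
someVertex {D = D} bound = fromℕ< (≤-trans 1≤D (≤-trans (m≤m+n D D) (<⇒≤ D+D<N)))
  where open DegreeBound bound

record MycielskiInvariant (G : Graph) : Set where
  field
    irreflexive                 : Irreflexive G
    twinFree                    : TwinFree G
    D                           : ℕ
    degreeBound                 : DegreeBound G D
    a b                         : Fin (N G)
    pair-determining            : Determining G (pair a b)
    nontrivialVertexStabilisers : NontrivialVertexStabilisers G

mapKind : ∀ {n} → (Fin n → Fin n) → MKind n → MKind n
mapKind h (vK i) = vK (h i)
mapKind h (uK i) = uK (h i)
mapKind h wK     = wK

μadj-mapKind : ∀ {n} {A : Fin n → Fin n → Bool} {h : Fin n → Fin n} → (∀ i j → A (h i) (h j) ≡ A i j) →
  ∀ k l → μadj A (mapKind h k) (mapKind h l) ≡ μadj A k l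
μadj-mapKind h-pres (vK i) (vK j) = h-pres i j
μadj-mapKind h-pres (vK i) (uK j) = h-pres i j
μadj-mapKind h-pres (uK i) (vK j) = h-pres i j
μadj-mapKind h-pres (vK i) wK     = refl
μadj-mapKind h-pres (uK i) (uK j) = refl
μadj-mapKind h-pres (uK i) wK     = refl
μadj-mapKind h-pres wK     (vK j) = refl
μadj-mapKind h-pres wK     (uK j) = refl
μadj-mapKind h-pres wK     wK     = refl

module Mycielskian (G : Graph) where

  private
    n = N G
    A = adj G

  H : Graph
  H = μ G

  w : Fin (N H)
  w = zero

  v u : Fin n → Fin (N H)
  v i = suc (i ↑ˡ n)
  u i = suc (n ↑ʳ i)

  data View : Fin (N H) → Set where
    isw : View w
    isv : ∀ i → View (v i)
    isu : ∀ i → View (u i)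

  view : ∀ x → View x
  view zero = isw
  view (suc x) with splitAt n x | join-splitAt n n x
  ... | inj₁ i | refl = isv i
  ... | inj₂ i | refl = isu i

  kindOf : ∀ {x} → View x → MKind n
  kindOf isw     = wK
  kindOf (isv i) = vK i
  kindOf (isu i) = uK i

  kind-view : ∀ {x} (vx : View x) → kind n x ≡ kindOf vx
  kind-view isw = refl
  kind-view (isv i) rewrite splitAt-↑ˡ n i n = refl
  kind-view (isu i) rewrite splitAt-↑ʳ n n i = refl

  adj-view : ∀ {x y} (vx : View x) (vy : View y) → adj H x y ≡ μadj A (kindOf vx) (kindOf vy)
  adj-view vx vy = cong₂ (μadj A) (kind-view vx) (kind-view vy)

  v-injective : ∀ {i j} → v i ≡ v j → i ≡ j
  v-injective = ↑ˡ-injective n _ _ ∘ fsuc-injective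

  u-injective : ∀ {i j} → u i ≡ u j → i ≡ j
  u-injective = ↑ʳ-injective n _ _ ∘ fsuc-injective

  v≢u : ∀ {i j} → v i ≢ u j
  v≢u {i} {j} vi≡uj with trans (sym (kind-view (isv i))) (trans (cong (kind n) vi≡uj) (kind-view (isu j)))
  ... | ()

  irreflexive-μ : Irreflexive G → Irreflexive H
  irreflexive-μ irreflexive x = loopless (view x)
    where
    loopless : ∀ {x} → View x → adj H x x ≡ false
    loopless isw     = refl
    loopless (isv i) = trans (adj-view (isv i) (isv i)) (irreflexive i)
    loopless (isu i) = adj-view (isu i) (isu i)

  twinFree-μ : Irreflexive G → TwinFree G → TwinFree H
  twinFree-μ irreflexive twinFree x y = twins (view x) (view y)
    where
    sameKind : ∀ {x y z} (vx : View x) (vy : View y) (vz : View z) → (∀ z → adj H x z ≡ adj H y z) →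
      μadj A (kindOf vx) (kindOf vz) ≡ μadj A (kindOf vy) (kindOf vz)
    sameKind {z = z} vx vy vz same = trans (sym (adj-view vx vz)) (trans (same z) (adj-view vy vz))
    twins : ∀ {x y} → View x → View y → (∀ z → adj H x z ≡ adj H y z) → x ≡ y
    twins isw     isw     _    = refl
    twins (isv i) (isv j) same = cong v (twinFree i j λ z → sameKind (isv i) (isv j) (isv z) same)
    twins (isu i) (isu j) same = cong u (twinFree i j λ z → sameKind (isu i) (isu j) (isv z) same)
    twins isw     (isv i) same = contradiction (trans (sameKind isw (isv i) (isu i) same) (irreflexive i)) λ ()
    twins (isv i) isw     same = contradiction (trans (sym (sameKind (isv i) isw (isu i) same)) (irreflexive i)) λ ()
    twins isw     (isu i) same = contradiction (sameKind isw (isu i) isw same) λ ()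
    twins (isu i) isw     same = contradiction (sameKind (isu i) isw isw same) λ ()
    twins (isv i) (isu j) same = contradiction (sameKind (isv i) (isu j) isw same) λ ()
    twins (isu i) (isv j) same = contradiction (sameKind (isu i) (isv j) isw same) λ ()

  deg-view : ∀ {x} (vx : View x) → deg H x ≡ boolToℕ (μadj A (kindOf vx) wK)
    + (sum (λ i → boolToℕ (μadj A (kindOf vx) (vK i))) + sum (λ i → boolToℕ (μadj A (kindOf vx) (uK i))))
  deg-view {x} vx = begin
    deg H x
      ≡⟨ cong (boolToℕ (adj H x w) +_) (sum-↑ n n (boolToℕ ∘ adj H x ∘ suc)) ⟩
    boolToℕ (adj H x w) + (sum (boolToℕ ∘ adj H x ∘ v) + sum (boolToℕ ∘ adj H x ∘ u))
      ≡⟨ cong₂ _+_ (cong boolToℕ (adj-view vx isw))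
                   (cong₂ _+_ (sum-cong-≗ (cong boolToℕ ∘ adj-view vx ∘ isv))
                              (sum-cong-≗ (cong boolToℕ ∘ adj-view vx ∘ isu))) ⟩
    _ ∎

  deg-w : deg H w ≡ n
  deg-w = trans (deg-view isw) (cong₂ _+_ (sum-replicate-zero n) (sum-ones n))

  deg-v : ∀ i → deg H (v i) ≡ deg G i + deg G i
  deg-v i = deg-view (isv i)

  deg-u : ∀ i → deg H (u i) ≡ suc (deg G i)
  deg-u i = trans (deg-view (isu i)) (cong suc (trans (cong (deg G i +_) (sum-replicate-zero n)) (+-identityʳ _)))

  module _ {D} (bound : DegreeBound G D) where
    open DegreeBound bound

    deg-v≤ : ∀ i → deg H (v i) ≤ D + D
    deg-v≤ i = ≤-trans (≤-reflexive (deg-v i)) (+-mono-≤ (deg≤D i) (deg≤D i))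

    deg-u≤ : ∀ i → deg H (u i) ≤ D + D
    deg-u≤ i = ≤-trans (≤-reflexive (deg-u i)) (≤-trans (s≤s (deg≤D i)) (+-monoˡ-≤ D 1≤D))

    degreeBound-μ : DegreeBound H n
    degreeBound-μ = record
      { deg≤D = λ x → deg≤n (view x) ; 1≤D = ≤-trans 1≤D (≤-trans (m≤m+n D D) (<⇒≤ D+D<N)) ; D+D<N = ≤-refl }
      where
      deg≤n : ∀ {x} → View x → deg H x ≤ n
      deg≤n isw     = ≤-reflexive deg-w
      deg≤n (isv i) = ≤-trans (deg-v≤ i) (<⇒≤ D+D<N)
      deg≤n (isu i) = ≤-trans (deg-u≤ i) (<⇒≤ D+D<N)

    w-fixed : (σ : Aut H) → f σ w ≡ w
    w-fixed σ = only-w (view (f σ w)) (trans (deg-aut σ w) deg-w)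
      where
      only-w : ∀ {x} → View x → deg H x ≡ n → x ≡ w
      only-w isw     _    = refl
      only-w (isv i) d≡n = contradiction (subst (_≤ D + D) d≡n (deg-v≤ i)) (<⇒≱ D+D<N)
      only-w (isu i) d≡n = contradiction (subst (_≤ D + D) d≡n (deg-u≤ i)) (<⇒≱ D+D<N)

  module _ (σ : Aut H) (σw≡w : f σ w ≡ w) where

    v↦v : ∀ i → ∃ λ j → f σ (v i) ≡ v j
    v↦v i = image (view (f σ (v i))) refl
      where
      image : ∀ {y} → View y → f σ (v i) ≡ y → ∃ λ j → f σ (v i) ≡ v j
      image isw     σvi≡w  = contradiction (f-injective σ (trans σvi≡w (sym σw≡w))) λ ()
      image (isv j) σvi≡vj = j , σvi≡vj
      image (isu j) σvi≡uj = contradiction (begin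
        true                 ≡⟨ sym (adj-view (isu j) isw) ⟩
        adj H (u j) w        ≡⟨ cong (λ y → adj H y w) (sym σvi≡uj) ⟩
        adj H (f σ (v i)) w  ≡⟨ adj-fixed σ σw≡w (v i) ⟩
        adj H (v i) w        ≡⟨ adj-view (isv i) isw ⟩
        false                ∎) λ ()

    u↦u : ∀ i → ∃ λ j → f σ (u i) ≡ u j
    u↦u i = image (view (f σ (u i))) refl
      where
      image : ∀ {y} → View y → f σ (u i) ≡ y → ∃ λ j → f σ (u i) ≡ u j
      image isw     σui≡w  = contradiction (f-injective σ (trans σui≡w (sym σw≡w))) λ ()
      image (isu j) σui≡uj = j , σui≡uj
      image (isv j) σui≡vj = contradiction (begin
        false                ≡⟨ sym (adj-view (isv j) isw) ⟩
        adj H (v j) w        ≡⟨ cong (λ y → adj H y w) (sym σui≡vj) ⟩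
        adj H (f σ (u i)) w  ≡⟨ adj-fixed σ σw≡w (u i) ⟩
        adj H (u i) w        ≡⟨ adj-view (isu i) isw ⟩
        true                 ∎) λ ()

  ⁻¹-fixes-w : ∀ (σ : Aut H) → f σ w ≡ w → f (σ ⁻¹) w ≡ w
  ⁻¹-fixes-w σ σw≡w = trans (cong (g σ) (sym σw≡w)) (gf σ w)

  restrictᶠ : (σ : Aut H) → f σ w ≡ w → Fin n → Fin n
  restrictᶠ σ σw≡w i = proj₁ (v↦v σ σw≡w i)

  restrictᶠ-inverse : ∀ (σ τ : Aut H) (σw≡w : f σ w ≡ w) (τw≡w : f τ w ≡ w) → (∀ x → f σ (f τ x) ≡ x) →
    ∀ i → restrictᶠ σ σw≡w (restrictᶠ τ τw≡w i) ≡ i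
  restrictᶠ-inverse σ τ σw≡w τw≡w στ≡id i = v-injective (begin
    v (restrictᶠ σ σw≡w (restrictᶠ τ τw≡w i)) ≡⟨ sym (proj₂ (v↦v σ σw≡w _)) ⟩
    f σ (v (restrictᶠ τ τw≡w i))               ≡⟨ cong (f σ) (sym (proj₂ (v↦v τ τw≡w i))) ⟩
    f σ (f τ (v i))                            ≡⟨ στ≡id (v i) ⟩
    v i                                        ∎)

  restrict : (σ : Aut H) → f σ w ≡ w → Aut G
  restrict σ σw≡w = record
    { f    = restrictᶠ σ σw≡w
    ; g    = restrictᶠ (σ ⁻¹) (⁻¹-fixes-w σ σw≡w)
    ; fg   = restrictᶠ-inverse σ (σ ⁻¹) σw≡w (⁻¹-fixes-w σ σw≡w) (fg σ)
    ; gf   = restrictᶠ-inverse (σ ⁻¹) σ (⁻¹-fixes-w σ σw≡w) σw≡w (gf σ)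
    ; pres = λ i j → begin
        A (restrictᶠ σ σw≡w i) (restrictᶠ σ σw≡w j)  ≡⟨ sym (adj-view (isv _) (isv _)) ⟩
        adj H (v _) (v _)                            ≡⟨ sym (cong₂ (adj H) (proj₂ (v↦v σ σw≡w i)) (proj₂ (v↦v σ σw≡w j))) ⟩
        adj H (f σ (v i)) (f σ (v j))                ≡⟨ pres σ (v i) (v j) ⟩
        adj H (v i) (v j)                            ≡⟨ adj-view (isv i) (isv j) ⟩
        A i j                                        ∎ }

  restrict-v : ∀ (σ : Aut H) (σw≡w : f σ w ≡ w) i → f σ (v i) ≡ v (f (restrict σ σw≡w) i)
  restrict-v σ σw≡w i = proj₂ (v↦v σ σw≡w i)

  -- The v-neighbours of σ (u i) = u j are the v (ρ k) with k adjacent to i, so j and ρ i are twins in G.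
  restrict-u : TwinFree G → ∀ (σ : Aut H) (σw≡w : f σ w ≡ w) i → f σ (u i) ≡ u (f (restrict σ σw≡w) i)
  restrict-u twinFree σ σw≡w i = trans σui≡uj (cong u (twinFree j (f ρ i) sameNeighbours))
    where
    ρ = restrict σ σw≡w
    j = proj₁ (u↦u σ σw≡w i)
    σui≡uj = proj₂ (u↦u σ σw≡w i)
    sameNeighbours : ∀ z → A j z ≡ A (f ρ i) z
    sameNeighbours z = begin
      A j z                          ≡⟨ cong (A j) (sym (fg ρ z)) ⟩
      A j (f ρ k)                    ≡⟨ sym (adj-view (isu j) (isv (f ρ k))) ⟩
      adj H (u j) (v (f ρ k))        ≡⟨ sym (cong₂ (adj H) σui≡uj (restrict-v σ σw≡w k)) ⟩
      adj H (f σ (u i)) (f σ (v k))  ≡⟨ pres σ (u i) (v k) ⟩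
      adj H (u i) (v k)              ≡⟨ adj-view (isu i) (isv k) ⟩
      A i k                          ≡⟨ sym (pres ρ i k) ⟩
      A (f ρ i) (f ρ k)              ≡⟨ cong (A (f ρ i)) (fg ρ z) ⟩
      A (f ρ i) z                    ∎
      where k = g ρ z

  restrict-identity : TwinFree G → ∀ (σ : Aut H) (σw≡w : f σ w ≡ w) → IsIdentity (restrict σ σw≡w) → IsIdentity σ
  restrict-identity twinFree σ σw≡w ρ≡id x = fixed (view x)
    where
    fixed : ∀ {x} → View x → f σ x ≡ x
    fixed isw     = σw≡w
    fixed (isv i) = trans (restrict-v σ σw≡w i) (cong v (ρ≡id i))
    fixed (isu i) = trans (restrict-u twinFree σ σw≡w i) (cong u (ρ≡id i))

  trivialStabiliser-μ : ∀ {D a b} → TwinFree G → DegreeBound G D → Determining G (pair a b) →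
    TrivialStabiliser H (pair (v a) (u b))
  trivialStabiliser-μ {a = a} {b} twinFree bound determining σ stabilises =
    restrict-identity twinFree σ σw≡w (determining ρ ρ-fixes)
    where
    σw≡w = w-fixed bound σ
    ρ = restrict σ σw≡w
    ρa≡a : f ρ a ≡ a
    ρa≡a with ∈pair⁻ (v a) (u b) (stabilises (∈pair⁺ˡ (v a) (u b)))
    ... | inj₁ σva≡va = v-injective (trans (sym (restrict-v σ σw≡w a)) σva≡va)
    ... | inj₂ σva≡ub = contradiction (trans (sym (restrict-v σ σw≡w a)) σva≡ub) v≢u
    ρb≡b : f ρ b ≡ b
    ρb≡b with ∈pair⁻ (v a) (u b) (stabilises (∈pair⁺ʳ (v a) (u b)))
    ... | inj₁ σub≡va = contradiction (trans (sym σub≡va) (restrict-u twinFree σ σw≡w b)) v≢u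
    ... | inj₂ σub≡ub = u-injective (trans (sym (restrict-u twinFree σ σw≡w b)) σub≡ub)
    ρ-fixes : ∀ x → x ∈ pair a b → f ρ x ≡ x
    ρ-fixes x x∈pair with ∈pair⁻ a b x∈pair
    ... | inj₁ refl = ρa≡a
    ... | inj₂ refl = ρb≡b

  liftᶠ : (Fin n → Fin n) → Fin (N H) → Fin (N H)
  liftᶠ h zero    = zero
  liftᶠ h (suc x) = suc (join n n (Sum.map h h (splitAt n x)))

  liftᶠ-v : ∀ h i → liftᶠ h (v i) ≡ v (h i)
  liftᶠ-v h i rewrite splitAt-↑ˡ n i n = refl

  liftᶠ-u : ∀ h i → liftᶠ h (u i) ≡ u (h i)
  liftᶠ-u h i rewrite splitAt-↑ʳ n n i = refl

  liftᶠ-inverse : ∀ {h k} → (∀ i → h (k i) ≡ i) → ∀ x → liftᶠ h (liftᶠ k x) ≡ x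
  liftᶠ-inverse {h} {k} hk≡id x with view x
  ... | isw   = refl
  ... | isv i = trans (cong (liftᶠ h) (liftᶠ-v k i)) (trans (liftᶠ-v h (k i)) (cong v (hk≡id i)))
  ... | isu i = trans (cong (liftᶠ h) (liftᶠ-u k i)) (trans (liftᶠ-u h (k i)) (cong u (hk≡id i)))

  kind-liftᶠ : ∀ h x → kind n (liftᶠ h x) ≡ mapKind h (kind n x)
  kind-liftᶠ h x with view x
  ... | isw   = refl
  ... | isv i = trans (cong (kind n) (liftᶠ-v h i)) (trans (kind-view (isv (h i))) (cong (mapKind h) (sym (kind-view (isv i)))))
  ... | isu i = trans (cong (kind n) (liftᶠ-u h i)) (trans (kind-view (isu (h i))) (cong (mapKind h) (sym (kind-view (isu i)))))

  lift : Aut G → Aut H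
  lift τ = record
    { f    = liftᶠ (f τ)
    ; g    = liftᶠ (g τ)
    ; fg   = liftᶠ-inverse (fg τ)
    ; gf   = liftᶠ-inverse (gf τ)
    ; pres = λ x y → trans (cong₂ (μadj A) (kind-liftᶠ (f τ) x) (kind-liftᶠ (f τ) y))
                           (μadj-mapKind (pres τ) (kind n x) (kind n y)) }

  lift-nonidentity : ∀ τ → ¬ IsIdentity τ → ¬ IsIdentity (lift τ)
  lift-nonidentity τ τ≢id lift≡id = τ≢id λ i → v-injective (trans (sym (liftᶠ-v (f τ) i)) (lift≡id (v i)))

  nontrivialVertexStabilisers-μ : Fin n → NontrivialVertexStabilisers G → NontrivialVertexStabilisers H
  nontrivialVertexStabilisers-μ i₀ nontrivial x = stabiliser (view x)
    where
    stabiliser : ∀ {x} → View x → ∃ λ (τ : Aut H) → f τ x ≡ x × ¬ IsIdentity τ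
    stabiliser isw =
      let τ , _ , τ≢id = nontrivial i₀ in lift τ , refl , lift-nonidentity τ τ≢id
    stabiliser (isv i) =
      let τ , τi≡i , τ≢id = nontrivial i in lift τ , trans (liftᶠ-v (f τ) i) (cong v τi≡i) , lift-nonidentity τ τ≢id
    stabiliser (isu i) =
      let τ , τi≡i , τ≢id = nontrivial i in lift τ , trans (liftᶠ-u (f τ) i) (cong u τi≡i) , lift-nonidentity τ τ≢id

  module _ (invariant : MycielskiInvariant G) where
    open MycielskiInvariant invariant

    invariant-μ : MycielskiInvariant H
    invariant-μ = record
      { irreflexive                 = irreflexive-μ irreflexive
      ; twinFree                    = twinFree-μ irreflexive twinFree
      ; D                           = n
      ; degreeBound                 = degreeBound-μ degreeBound
      ; a                           = v a
      ; b                           = u b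
      ; pair-determining            = trivialStabiliser⇒determining (trivialStabiliser-μ twinFree degreeBound pair-determining)
      ; nontrivialVertexStabilisers = nontrivialVertexStabilisers-μ (someVertex degreeBound) nontrivialVertexStabilisers }

    det≡dist≡ρ≡2-μ : IsDet H 2 × IsDist H 2 × IsRho H 2
    det≡dist≡ρ≡2-μ = det≡dist≡ρ≡2 v≢u (trivialStabiliser-μ twinFree degreeBound pair-determining)
      (nontrivialVertexStabilisers-μ (someVertex degreeBound) nontrivialVertexStabilisers)

-- The base case M₃ = C₅

C5 : Graph
C5 = M' 1

irreflexive-C5 : Irreflexive C5
irreflexive-C5 = from-yes (all? λ x → adj C5 x x Bool.≟ false)

twinFree-C5 : TwinFree C5
twinFree-C5 = from-yes (all? λ x → all? λ y → all? (λ z → adj C5 x z Bool.≟ adj C5 y z) →-dec (x ≟ y))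

degreeBound-C5 : DegreeBound C5 2
degreeBound-C5 = record { deg≤D = from-yes (all? λ x → deg C5 x ≤? 2) ; 1≤D = s≤s z≤n ; D+D<N = ≤-refl }

uniqueAdjacency? : ∀ G (a b y : Fin (N G)) → Dec (∀ z → adj G z a ≡ adj G y a → adj G z b ≡ adj G y b → z ≡ y)
uniqueAdjacency? G a b y = all? λ z → (adj G z a Bool.≟ adj G y a) →-dec ((adj G z b Bool.≟ adj G y b) →-dec (z ≟ y))

pair-determining-C5 : Determining C5 (pair 0F 1F)
pair-determining-C5 σ fixes = fixed
  where
  σ0≡0 = fixes 0F (∈pair⁺ˡ 0F 1F)
  σ1≡1 = fixes 1F (∈pair⁺ʳ 0F 1F)
  fixed : IsIdentity σ
  fixed 0F = σ0≡0
  fixed 1F = σ1≡1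
  fixed 2F = fixed-by-adjacency σ σ0≡0 σ1≡1 (from-yes (uniqueAdjacency? C5 0F 1F 2F))
  fixed 3F = fixed-by-adjacency σ σ0≡0 σ1≡1 (from-yes (uniqueAdjacency? C5 0F 1F 3F))
  fixed 4F = fixed-by-adjacency σ σ0≡0 σ1≡1 (from-yes (uniqueAdjacency? C5 0F 1F 4F))

-- With 0 = w, 1 = v₀, 2 = v₁, 3 = u₀, 4 = u₁, C₅ is the cycle 0 3 2 1 4, and reflection x is its reflection through x.
reflection : Fin 5 → Fin 5 → Fin 5
reflection x = lookup (lookup table x)
  where
  table : Vec (Vec (Fin 5) 5) 5
  table = (0F ∷ 2F ∷ 1F ∷ 4F ∷ 3F ∷ [])
        ∷ (3F ∷ 1F ∷ 4F ∷ 0F ∷ 2F ∷ [])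
        ∷ (4F ∷ 3F ∷ 2F ∷ 1F ∷ 0F ∷ [])
        ∷ (2F ∷ 4F ∷ 0F ∷ 3F ∷ 1F ∷ [])
        ∷ (1F ∷ 0F ∷ 3F ∷ 2F ∷ 4F ∷ [])
        ∷ []

reflection-involutive : ∀ x y → reflection x (reflection x y) ≡ y
reflection-involutive = from-yes (all? λ x → all? λ y → reflection x (reflection x y) ≟ y)

reflection-preserves : ∀ x y z → adj C5 (reflection x y) (reflection x z) ≡ adj C5 y z
reflection-preserves = from-yes (all? λ x → all? λ y → all? λ z → adj C5 (reflection x y) (reflection x z) Bool.≟ adj C5 y z)

reflection-fixes : ∀ x → reflection x x ≡ x
reflection-fixes = from-yes (all? λ x → reflection x x ≟ x)

reflection-moves : ∀ x → ∃ λ y → reflection x y ≢ y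
reflection-moves = from-yes (all? λ x → any? λ y → ¬? (reflection x y ≟ y))

reflectionAut : Fin 5 → Aut C5
reflectionAut x = record
  { f = reflection x ; g = reflection x
  ; fg = reflection-involutive x ; gf = reflection-involutive x ; pres = reflection-preserves x }

nontrivialVertexStabilisers-C5 : NontrivialVertexStabilisers C5
nontrivialVertexStabilisers-C5 x =
  reflectionAut x , reflection-fixes x , λ id → let y , moved = reflection-moves x in moved (id y)

invariant-C5 : MycielskiInvariant C5
invariant-C5 = record
  { irreflexive                 = irreflexive-C5
  ; twinFree                    = twinFree-C5
  ; D                           = 2
  ; degreeBound                 = degreeBound-C5
  ; a                           = 0F
  ; b                           = 1F
  ; pair-determining            = pair-determining-C5
  ; nontrivialVertexStabilisers = nontrivialVertexStabilisers-C5 }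

invariant-M' : ∀ k → MycielskiInvariant (M' (suc k))
invariant-M' zero    = invariant-C5
invariant-M' (suc k) = Mycielskian.invariant-μ (M' (suc k)) (invariant-M' k)

corollary1 : (n : ℕ) → n ≥ 4 →
    IsDet (Mycielski n) 2 × IsDist (Mycielski n) 2 × IsRho (Mycielski n) 2
corollary1 _ (s≤s (s≤s (s≤s (s≤s (z≤n {k}))))) = Mycielskian.det≡dist≡ρ≡2-μ (M' (suc k)) (invariant-M' k)
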